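{- Let $d\ge1$ and let $\Delta=\operatorname{conv}(v_1,\ldots,v_{2d})\subset\mathbb{R}^{2d-1}$ be a $(2d-1)$-dimensional lattice simplex whose codimension-$1$ facets are basic lattice simplices and such that $\mathrm{Int}(k\Delta)\cap\mathbb{Z}^{2d-1}=\emptyset$ for all $k=1,\ldots,d-1$. Let $\lambda_1,\ldots,\lambda_{2d}$ be real numbers with $0\le\lambda_i<1$ such that $\sum_{i=1}^{2d}\lambda_i(v_i,1)\in\mathbb{Z}^{2d}$. Then either $\sum_i\lambda_i=0$ or $\sum_i\lambda_i=d$. Moreover, if $\sum_i\lambda_i=d$, then $\lambda_i\neq0$ for all $i$.
   Context: A $k$-dimensional lattice simplex $\operatorname{conv}(w_1,\ldots,w_{k+1})\subset\mathbb{R}^m$ is basic if $w_1-w_{k+1},\ldots,w_k-w_{k+1}$ is part of a lattice basis of $\mathbb{Z}^m$.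
   Formalization: The coefficients λ_i are rational rather than real, and the barycentric coordinates describing interior lattice points of kΔ are taken in ℚ. -}

module Defs where

open import Data.Nat using (ℕ; zero; suc; _*_)
open import Data.Fin using (Fin; zero; suc; inject₁; fromℕ; punchIn)
open import Data.Integer as ℤ using (ℤ; +_)
open import Data.Rational as ℚ using (ℚ; 0ℚ; _/_)
open import Data.Product using (Σ; ∃; _×_)
open import Relation.Binary.PropositionalEquality using (_≡_)
open import Function.Definitions using (Injective)

Point : ℕ → Set
Point m = Fin m → ℤ

sumℤ : ∀ {n} → (Fin n → ℤ) → ℤ
sumℤ {zero}  f = + 0
sumℤ {suc n} f = f zero ℤ.+ sumℤ (λ i → f (suc i))

sumℚ : ∀ {n} → (Fin n → ℚ) → ℚ
sumℚ {zero}  f = 0ℚ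
sumℚ {suc n} f = f zero ℚ.+ sumℚ (λ i → f (suc i))

ℤ→ℚ : ℤ → ℚ
ℤ→ℚ z = z / 1

ℕ→ℚ : ℕ → ℚ
ℕ→ℚ n = + n / 1

IsInt : ℚ → Set
IsInt q = ∃ λ (z : ℤ) → q ≡ ℤ→ℚ z

IsLatticeBasis : (m : ℕ) → (Fin m → Point m) → Set
IsLatticeBasis m b =
  ((z : Point m) → ∃ λ (c : Fin m → ℤ) → ∀ j → z j ≡ sumℤ (λ i → c i ℤ.* b i j))
  × ((c : Fin m → ℤ) → (∀ j → sumℤ (λ i → c i ℤ.* b i j) ≡ + 0) → ∀ i → c i ≡ + 0)

PartOfLatticeBasis : (k m : ℕ) → (Fin k → Point m) → Set
PartOfLatticeBasis k m u =
  Σ (Fin m → Point m) λ b → IsLatticeBasis m b ×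
    Σ (Fin k → Fin m) λ ι → Injective _≡_ _≡_ ι × (∀ i j → b (ι i) j ≡ u i j)

IsBasicSimplex : (k m : ℕ) → (Fin (suc k) → Point m) → Set
IsBasicSimplex k m w =
  PartOfLatticeBasis k m (λ i j → w (inject₁ i) j ℤ.- w (fromℕ k) j)

AffinelyIndependent : (m : ℕ) → (Fin (suc m) → Point m) → Set
AffinelyIndependent m v =
  (c : Fin (suc m) → ℚ) → sumℚ c ≡ 0ℚ →
  (∀ j → sumℚ (λ i → c i ℚ.* ℤ→ℚ (v i j)) ≡ 0ℚ) → ∀ i → c i ≡ 0ℚ

-- the interior of k·conv(v₀,…,v_m) (full-dimensional) contains a point of ℤ^m:
-- a lattice point Σ μ_i v_i with all μ_i > 0 and Σ μ_i = k
HasInteriorLatticePoint : (m : ℕ) → (Fin (suc m) → Point m) → ℕ → Set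
HasInteriorLatticePoint m v k =
  Σ (Point m) λ z → Σ (Fin (suc m) → ℚ) λ μ →
    (∀ i → 0ℚ ℚ.< μ i) × sumℚ μ ≡ ℕ→ℚ k ×
    (∀ j → sumℚ (λ i → μ i ℚ.* ℤ→ℚ (v i j)) ≡ ℤ→ℚ (z j))

-- If some λⱼ vanishes, λ lies on the facet opposite vⱼ, which is basic; lattice points have
-- integral barycentric coordinates with respect to a basic simplex, so every λᵢ, lying in
-- [0,1), is 0.  Otherwise all λᵢ lie in (0,1) and k = Σλᵢ is a positive integer; then
-- Σλᵢvᵢ and Σ(1-λᵢ)vᵢ are interior lattice points of kΔ and (2d-k)Δ, so the emptiness of
-- Int(jΔ) for j < d forces k ≥ d and 2d-k ≥ d, i.e. k = d.
module Submission where

open import Defs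
open import Data.Nat as ℕ using (ℕ; zero; suc; _*_; _≤_)
import Data.Nat.Properties as ℕP
open import Data.Integer as ℤ using (ℤ; +_; -[1+_])
import Data.Integer.Properties as ℤP
open import Data.Rational as ℚ using (ℚ; 0ℚ; 1ℚ; mkℚ)
import Data.Rational.Properties as ℚP
import Data.Rational.Unnormalised as ℚᵘ
import Data.Rational.Unnormalised.Properties as ℚᵘP
open import Data.Rational.Solver using (module +-*-Solver)
import Data.Nat.Coprimality as Coprime
open import Data.Fin as Fin using (Fin; zero; suc; inject₁; fromℕ; punchIn; punchOut; lower₁)
import Data.Fin.Properties as FinP
open import Data.Product using (∃; _,_; proj₁; proj₂; _×_)
open import Data.Sum using (_⊎_; inj₁; inj₂)
open import Data.Empty using (⊥-elim)
open import Function using (_∘_)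
open import Function.Definitions using (Injective)
open import Algebra.Bundles using (CommutativeRing)
import Algebra.Properties.Semiring.Sum as SemiringSum
open import Algebra.Properties.Group ℚP.+-0-group using (x∙y⁻¹≈ε⇒x≈y)
open import Relation.Nullary using (¬_; yes; no)
open import Relation.Binary.Definitions using (tri<; tri≈; tri>)
open import Relation.Binary.PropositionalEquality
open +-*-Solver using (solve; _:=_; _:+_; _:*_; _:-_; con)

ℤ→ℚ≡mkℚ : ∀ z → ℤ→ℚ z ≡ mkℚ z 0 (Coprime.sym (Coprime.1-coprimeTo ℤ.∣ z ∣))
ℤ→ℚ≡mkℚ z = ℚP.↥p/↧p≡p _

ℤ→ℚ-homo-+ : ∀ a b → ℤ→ℚ (a ℤ.+ b) ≡ ℤ→ℚ a ℚ.+ ℤ→ℚ b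
ℤ→ℚ-homo-+ a b rewrite ℤ→ℚ≡mkℚ a | ℤ→ℚ≡mkℚ b | ℤP.*-identityʳ a | ℤP.*-identityʳ b = refl

ℤ→ℚ-homo-* : ∀ a b → ℤ→ℚ (a ℤ.* b) ≡ ℤ→ℚ a ℚ.* ℤ→ℚ b
ℤ→ℚ-homo-* a b rewrite ℤ→ℚ≡mkℚ a | ℤ→ℚ≡mkℚ b = refl

ℤ→ℚ-homo-neg : ∀ a → ℤ→ℚ (ℤ.- a) ≡ ℚ.- ℤ→ℚ a
ℤ→ℚ-homo-neg a rewrite ℤ→ℚ≡mkℚ a | ℤ→ℚ≡mkℚ (ℤ.- a) with a
... | + zero   = refl
... | + suc n  = refl
... | -[1+ n ] = refl

ℤ→ℚ-homo-- : ∀ a b → ℤ→ℚ (a ℤ.- b) ≡ ℤ→ℚ a ℚ.- ℤ→ℚ b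
ℤ→ℚ-homo-- a b = trans (ℤ→ℚ-homo-+ a (ℤ.- b)) (cong (ℤ→ℚ a ℚ.+_) (ℤ→ℚ-homo-neg b))

ℤ→ℚ-injective : ∀ {a b} → ℤ→ℚ a ≡ ℤ→ℚ b → a ≡ b
ℤ→ℚ-injective {a} {b} eq rewrite ℤ→ℚ≡mkℚ a | ℤ→ℚ≡mkℚ b = cong ℚ.↥_ eq

ℤ→ℚ-mono-< : ∀ {a b} → a ℤ.< b → ℤ→ℚ a ℚ.< ℤ→ℚ b
ℤ→ℚ-mono-< {a} {b} a<b rewrite ℤ→ℚ≡mkℚ a | ℤ→ℚ≡mkℚ b =
  ℚ.*<* (subst₂ ℤ._<_ (sym (ℤP.*-identityʳ a)) (sym (ℤP.*-identityʳ b)) a<b)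

ℤ→ℚ-cancel-< : ∀ {a b} → ℤ→ℚ a ℚ.< ℤ→ℚ b → a ℤ.< b
ℤ→ℚ-cancel-< {a} {b} lt rewrite ℤ→ℚ≡mkℚ a | ℤ→ℚ≡mkℚ b =
  subst₂ ℤ._<_ (ℤP.*-identityʳ a) (ℤP.*-identityʳ b) (ℚP.drop-*<* lt)

ℤ→ℚ-sumℤ : ∀ {n} (f : Fin n → ℤ) → ℤ→ℚ (sumℤ f) ≡ sumℚ (ℤ→ℚ ∘ f)
ℤ→ℚ-sumℤ {zero}  f = refl
ℤ→ℚ-sumℤ {suc n} f = trans (ℤ→ℚ-homo-+ (f zero) _) (cong (ℤ→ℚ (f zero) ℚ.+_) (ℤ→ℚ-sumℤ (f ∘ suc)))

ℕ→ℚ-homo-+ : ∀ m n → ℕ→ℚ (m ℕ.+ n) ≡ ℕ→ℚ m ℚ.+ ℕ→ℚ n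
ℕ→ℚ-homo-+ m n = ℤ→ℚ-homo-+ (+ m) (+ n)

ℕ→ℚ-homo-* : ∀ m n → ℕ→ℚ (m ℕ.* n) ≡ ℕ→ℚ m ℚ.* ℕ→ℚ n
ℕ→ℚ-homo-* m n = trans (cong ℤ→ℚ (ℤP.pos-* m n)) (ℤ→ℚ-homo-* (+ m) (+ n))

ℕ→ℚ-injective : ∀ {m n} → ℕ→ℚ m ≡ ℕ→ℚ n → m ≡ n
ℕ→ℚ-injective = ℤP.+-injective ∘ ℤ→ℚ-injective

ℕ→ℚ-positive : ∀ n → ℚ.Positive (ℕ→ℚ (suc n))
ℕ→ℚ-positive n = ℚ.positive (ℤ→ℚ-mono-< {+ 0} {+ suc n} (ℤ.+<+ (ℕ.s≤s ℕ.z≤n)))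

*-cancelˡ-≡-pos : ∀ r .{{_ : ℚ.Positive r}} {p q} → r ℚ.* p ≡ r ℚ.* q → p ≡ q
*-cancelˡ-≡-pos r {p} {q} rp≡rq = ℚP.≤-antisym
  (ℚP.*-cancelˡ-≤-pos {p} {q} r (ℚP.≤-reflexive rp≡rq))
  (ℚP.*-cancelˡ-≤-pos {q} {p} r (ℚP.≤-reflexive (sym rp≡rq)))

0≤∧≢0⇒0< : ∀ {q} → 0ℚ ℚ.≤ q → q ≢ 0ℚ → 0ℚ ℚ.< q
0≤∧≢0⇒0< {q} 0≤q q≢0 with ℚP.<-cmp 0ℚ q
... | tri< 0<q _ _ = 0<q
... | tri≈ _ 0≡q _ = ⊥-elim (q≢0 (sym 0≡q))
... | tri> _ _ q<0 = ⊥-elim (ℚP.<-irrefl refl (ℚP.<-≤-trans q<0 0≤q))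

↧*≡↥ : ∀ q → ℕ→ℚ (ℚ.↧ₙ q) ℚ.* q ≡ ℤ→ℚ (ℚ.↥ q)
↧*≡↥ q@(mkℚ n d-1 _) rewrite ℤ→ℚ≡mkℚ (+ suc d-1) | ℤ→ℚ≡mkℚ n =
  ℚP.toℚᵘ-injective (ℚᵘP.≃-trans (ℚP.toℚᵘ-homo-* (mkℚ (+ suc d-1) 0 (Coprime.sym (Coprime.1-coprimeTo _))) q)
                                 (ℚᵘ.*≡* cross))
  where
  cross : (+ suc d-1 ℤ.* n) ℤ.* + 1 ≡ n ℤ.* + suc (d-1 ℕ.+ 0)
  cross rewrite ℕP.+-identityʳ d-1 | ℤP.*-identityʳ (+ suc d-1 ℤ.* n) = ℤP.*-comm (+ suc d-1) n

module Sum = SemiringSum (CommutativeRing.semiring ℚP.+-*-commutativeRing)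

sumℚ≡sum : ∀ {n} (f : Fin n → ℚ) → sumℚ f ≡ Sum.sum f
sumℚ≡sum {zero}  f = refl
sumℚ≡sum {suc n} f = cong (f zero ℚ.+_) (sumℚ≡sum (f ∘ suc))

sumℚ-cong : ∀ {n} {f g : Fin n → ℚ} → (∀ i → f i ≡ g i) → sumℚ f ≡ sumℚ g
sumℚ-cong {f = f} {g} f≗g = trans (sumℚ≡sum f) (trans (Sum.sum-cong-≗ f≗g) (sym (sumℚ≡sum g)))

sumℚ-distrib-+ : ∀ {n} (f g : Fin n → ℚ) → sumℚ (λ i → f i ℚ.+ g i) ≡ sumℚ f ℚ.+ sumℚ g
sumℚ-distrib-+ f g = begin
  sumℚ (λ i → f i ℚ.+ g i)    ≡⟨ sumℚ≡sum (λ i → f i ℚ.+ g i) ⟩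
  Sum.sum (λ i → f i ℚ.+ g i) ≡⟨ Sum.∑-distrib-+ f g ⟩
  Sum.sum f ℚ.+ Sum.sum g     ≡⟨ cong₂ ℚ._+_ (sumℚ≡sum f) (sumℚ≡sum g) ⟨
  sumℚ f ℚ.+ sumℚ g           ∎
  where open ≡-Reasoning

*-distribˡ-sumℚ : ∀ {n} x (f : Fin n → ℚ) → x ℚ.* sumℚ f ≡ sumℚ (λ i → x ℚ.* f i)
*-distribˡ-sumℚ x f =
  trans (cong (x ℚ.*_) (sumℚ≡sum f)) (trans (Sum.*-distribˡ-sum x f) (sym (sumℚ≡sum (λ i → x ℚ.* f i))))

*-distribʳ-sumℚ : ∀ {n} x (f : Fin n → ℚ) → sumℚ f ℚ.* x ≡ sumℚ (λ i → f i ℚ.* x)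
*-distribʳ-sumℚ x f =
  trans (cong (ℚ._* x) (sumℚ≡sum f)) (trans (Sum.*-distribʳ-sum x f) (sym (sumℚ≡sum (λ i → f i ℚ.* x))))

sumℚ-comm : ∀ {m n} (F : Fin m → Fin n → ℚ) →
            sumℚ (λ i → sumℚ (F i)) ≡ sumℚ (λ k → sumℚ (λ i → F i k))
sumℚ-comm F = begin
  sumℚ (λ i → sumℚ (F i))
    ≡⟨ trans (sumℚ≡sum (λ i → sumℚ (F i))) (Sum.sum-cong-≗ (sumℚ≡sum ∘ F)) ⟩
  Sum.sum (λ i → Sum.sum (F i))
    ≡⟨ Sum.∑-comm F ⟩
  Sum.sum (λ k → Sum.sum (λ i → F i k))
    ≡⟨ trans (sumℚ≡sum (λ k → sumℚ (λ i → F i k))) (Sum.sum-cong-≗ (λ k → sumℚ≡sum (λ i → F i k))) ⟨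
  sumℚ (λ k → sumℚ (λ i → F i k)) ∎
  where open ≡-Reasoning

sumℚ-init-last : ∀ {n} (f : Fin (suc n) → ℚ) → sumℚ f ≡ sumℚ (f ∘ inject₁) ℚ.+ f (fromℕ n)
sumℚ-init-last f =
  trans (sumℚ≡sum f) (trans (Sum.sum-init-last f) (cong (ℚ._+ f (fromℕ _)) (sym (sumℚ≡sum (f ∘ inject₁)))))

sumℚ-remove : ∀ {n} (j : Fin (suc n)) (f : Fin (suc n) → ℚ) → sumℚ f ≡ f j ℚ.+ sumℚ (f ∘ punchIn j)
sumℚ-remove j f =
  trans (sumℚ≡sum f) (trans (Sum.sum-remove {i = j} f) (cong (f j ℚ.+_) (sym (sumℚ≡sum (f ∘ punchIn j)))))

sumℚ-remove-zero : ∀ {n} (j : Fin (suc n)) (f : Fin (suc n) → ℚ) → f j ≡ 0ℚ → sumℚ f ≡ sumℚ (f ∘ punchIn j)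
sumℚ-remove-zero j f fj≡0 =
  trans (sumℚ-remove j f) (trans (cong (ℚ._+ sumℚ (f ∘ punchIn j)) fj≡0) (ℚP.+-identityˡ _))

sumℚ-neg : ∀ {n} (f : Fin n → ℚ) → sumℚ (λ i → ℚ.- f i) ≡ ℚ.- sumℚ f
sumℚ-neg {zero}  f = refl
sumℚ-neg {suc n} f =
  trans (cong (ℚ.- f zero ℚ.+_) (sumℚ-neg (f ∘ suc))) (sym (ℚP.neg-distrib-+ (f zero) (sumℚ (f ∘ suc))))

sumℚ-distrib-- : ∀ {n} (f g : Fin n → ℚ) → sumℚ (λ i → f i ℚ.- g i) ≡ sumℚ f ℚ.- sumℚ g
sumℚ-distrib-- f g = trans (sumℚ-distrib-+ f (ℚ.-_ ∘ g)) (cong (sumℚ f ℚ.+_) (sumℚ-neg g))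

sumℚ-zeros : ∀ {n} {f : Fin n → ℚ} → (∀ i → f i ≡ 0ℚ) → sumℚ f ≡ 0ℚ
sumℚ-zeros {zero}  f≡0 = refl
sumℚ-zeros {suc n} f≡0 = trans (cong₂ ℚ._+_ (f≡0 zero) (sumℚ-zeros (f≡0 ∘ suc))) (ℚP.+-identityˡ 0ℚ)

sumℚ-ones : ∀ n → sumℚ {n} (λ _ → 1ℚ) ≡ ℕ→ℚ n
sumℚ-ones zero    = refl
sumℚ-ones (suc n) = trans (cong (1ℚ ℚ.+_) (sumℚ-ones n)) (sym (ℕ→ℚ-homo-+ 1 n))

sumℚ-pos : ∀ {n} (f : Fin (suc n) → ℚ) → (∀ i → 0ℚ ℚ.< f i) → 0ℚ ℚ.< sumℚ f
sumℚ-pos {zero}  f f>0 = subst (0ℚ ℚ.<_) (sym (ℚP.+-identityʳ (f zero))) (f>0 zero)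
sumℚ-pos {suc n} f f>0 =
  subst (ℚ._< sumℚ f) (ℚP.+-identityˡ 0ℚ) (ℚP.+-mono-< (f>0 zero) (sumℚ-pos (f ∘ suc) (f>0 ∘ suc)))

δ : ∀ {n} → Fin n → Fin n → ℚ
δ zero    zero    = 1ℚ
δ zero    (suc _) = 0ℚ
δ (suc _) zero    = 0ℚ
δ (suc i) (suc k) = δ i k

δ-sym : ∀ {n} (i k : Fin n) → δ i k ≡ δ k i
δ-sym zero    zero    = refl
δ-sym zero    (suc k) = refl
δ-sym (suc i) zero    = refl
δ-sym (suc i) (suc k) = δ-sym i k

δ-refl : ∀ {n} (i : Fin n) → δ i i ≡ 1ℚ
δ-refl zero    = refl
δ-refl (suc i) = δ-refl i

δ-≢ : ∀ {n} {i k : Fin n} → i ≢ k → δ i k ≡ 0ℚ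
δ-≢ {i = zero}  {zero}  i≢k = ⊥-elim (i≢k refl)
δ-≢ {i = zero}  {suc k} i≢k = refl
δ-≢ {i = suc i} {zero}  i≢k = refl
δ-≢ {i = suc i} {suc k} i≢k = δ-≢ (i≢k ∘ cong suc)

δ-injective : ∀ {m n} {ι : Fin m → Fin n} → Injective _≡_ _≡_ ι → ∀ i j → δ (ι i) (ι j) ≡ δ i j
δ-injective {ι = ι} ι-inj i j with i FinP.≟ j
... | yes refl = trans (δ-refl (ι i)) (sym (δ-refl i))
... | no  i≢j  = trans (δ-≢ (i≢j ∘ ι-inj)) (sym (δ-≢ i≢j))

sumℚ-δ : ∀ {n} (i : Fin n) (f : Fin n → ℚ) → sumℚ (λ k → δ i k ℚ.* f k) ≡ f i
sumℚ-δ zero f = begin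
  1ℚ ℚ.* f zero ℚ.+ sumℚ (λ k → 0ℚ ℚ.* f (suc k))
    ≡⟨ cong₂ ℚ._+_ (ℚP.*-identityˡ (f zero)) (sumℚ-zeros (ℚP.*-zeroˡ ∘ f ∘ suc)) ⟩
  f zero ℚ.+ 0ℚ
    ≡⟨ ℚP.+-identityʳ (f zero) ⟩
  f zero ∎
  where open ≡-Reasoning
sumℚ-δ (suc i) f = begin
  0ℚ ℚ.* f zero ℚ.+ sumℚ (λ k → δ i k ℚ.* f (suc k))
    ≡⟨ cong₂ ℚ._+_ (ℚP.*-zeroˡ (f zero)) (sumℚ-δ i (f ∘ suc)) ⟩
  0ℚ ℚ.+ f (suc i)
    ≡⟨ ℚP.+-identityˡ (f (suc i)) ⟩
  f (suc i) ∎
  where open ≡-Reasoning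

pushforward : ∀ {m n} → (Fin m → Fin n) → (Fin m → ℚ) → Fin n → ℚ
pushforward ι r k = sumℚ (λ i → r i ℚ.* δ (ι i) k)

sumℚ-pushforward : ∀ {m n} (ι : Fin m → Fin n) (r : Fin m → ℚ) (f : Fin n → ℚ) →
                   sumℚ (λ k → pushforward ι r k ℚ.* f k) ≡ sumℚ (λ i → r i ℚ.* f (ι i))
sumℚ-pushforward ι r f = begin
  sumℚ (λ k → pushforward ι r k ℚ.* f k)
    ≡⟨ sumℚ-cong (λ k → *-distribʳ-sumℚ (f k) (λ i → r i ℚ.* δ (ι i) k)) ⟩
  sumℚ (λ k → sumℚ (λ i → r i ℚ.* δ (ι i) k ℚ.* f k))
    ≡⟨ sumℚ-comm (λ i k → r i ℚ.* δ (ι i) k ℚ.* f k) ⟨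
  sumℚ (λ i → sumℚ (λ k → r i ℚ.* δ (ι i) k ℚ.* f k))
    ≡⟨ sumℚ-cong (λ i → sumℚ-cong (λ k → ℚP.*-assoc (r i) (δ (ι i) k) (f k))) ⟩
  sumℚ (λ i → sumℚ (λ k → r i ℚ.* (δ (ι i) k ℚ.* f k)))
    ≡⟨ sumℚ-cong (λ i → *-distribˡ-sumℚ (r i) (λ k → δ (ι i) k ℚ.* f k)) ⟨
  sumℚ (λ i → r i ℚ.* sumℚ (λ k → δ (ι i) k ℚ.* f k))
    ≡⟨ sumℚ-cong (λ i → cong (r i ℚ.*_) (sumℚ-δ (ι i) f)) ⟩
  sumℚ (λ i → r i ℚ.* f (ι i)) ∎
  where open ≡-Reasoning

pushforward-injective : ∀ {m n} {ι : Fin m → Fin n} → Injective _≡_ _≡_ ι →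
                        ∀ r j → pushforward ι r (ι j) ≡ r j
pushforward-injective {ι = ι} ι-inj r j = begin
  sumℚ (λ i → r i ℚ.* δ (ι i) (ι j)) ≡⟨ sumℚ-cong (λ i → cong (r i ℚ.*_) (δ-injective ι-inj i j)) ⟩
  sumℚ (λ i → r i ℚ.* δ i j)         ≡⟨ sumℚ-cong (λ i → trans (ℚP.*-comm (r i) (δ i j)) (cong (ℚ._* r i) (δ-sym i j))) ⟩
  sumℚ (λ i → δ j i ℚ.* r i)         ≡⟨ sumℚ-δ j r ⟩
  r j                                ∎
  where open ≡-Reasoning

IsInt-+ : ∀ {p q} → IsInt p → IsInt q → IsInt (p ℚ.+ q)
IsInt-+ (a , refl) (b , refl) = a ℤ.+ b , sym (ℤ→ℚ-homo-+ a b)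

IsInt-- : ∀ {p q} → IsInt p → IsInt q → IsInt (p ℚ.- q)
IsInt-- (a , refl) (b , refl) = a ℤ.- b , sym (ℤ→ℚ-homo-- a b)

IsInt-* : ∀ {p q} → IsInt p → IsInt q → IsInt (p ℚ.* q)
IsInt-* (a , refl) (b , refl) = a ℤ.* b , sym (ℤ→ℚ-homo-* a b)

IsInt-sumℚ : ∀ {n} {f : Fin n → ℚ} → (∀ i → IsInt (f i)) → IsInt (sumℚ f)
IsInt-sumℚ {zero}  f-int = + 0 , refl
IsInt-sumℚ {suc n} f-int = IsInt-+ (f-int zero) (IsInt-sumℚ (f-int ∘ suc))

IsFractional : ℚ → Set
IsFractional q = 0ℚ ℚ.≤ q × q ℚ.< 1ℚ

IsInt∧IsFractional⇒≡0 : ∀ {q} → IsInt q → IsFractional q → q ≡ 0ℚ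
IsInt∧IsFractional⇒≡0 (+ zero   , refl) _ = refl
IsInt∧IsFractional⇒≡0 (+ suc k  , refl) (_ , q<1) with ℤ→ℚ-cancel-< {+ suc k} {+ 1} q<1
... | ℤ.+<+ (ℕ.s≤s ())
IsInt∧IsFractional⇒≡0 (-[1+ k ] , refl) (0≤q , _) =
  ⊥-elim (ℚP.<-irrefl refl (ℚP.<-≤-trans (ℤ→ℚ-mono-< { -[1+ k ]} {+ 0} ℤ.-<+) 0≤q))

IsInt∧pos⇒ℕ : ∀ {q} → IsInt q → 0ℚ ℚ.< q → ∃ λ k → q ≡ ℕ→ℚ (suc k)
IsInt∧pos⇒ℕ (+ suc k  , refl) _ = k , refl
IsInt∧pos⇒ℕ (+ zero   , refl) 0<0 with ℤ→ℚ-cancel-< {+ 0} {+ 0} 0<0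
... | ℤ.+<+ ()
IsInt∧pos⇒ℕ (-[1+ k ] , refl) 0<q with ℤ→ℚ-cancel-< {+ 0} { -[1+ k ]} 0<q
... | ()

commonDenominator : ∀ {n} (q : Fin n → ℚ) → ∃ λ D → ∀ i → IsInt (ℕ→ℚ (suc D) ℚ.* q i)
commonDenominator {zero}  q = 0 , λ ()
commonDenominator {suc n} q with commonDenominator (q ∘ suc)
... | D , Dq-int = D ℕ.+ ℚ.denominator-1 (q zero) ℕ.* suc D , Dq′-int
  where
  d = ℕ→ℚ (ℚ.↧ₙ (q zero))
  D′≡d*D : ℕ→ℚ (ℚ.↧ₙ (q zero) ℕ.* suc D) ≡ d ℚ.* ℕ→ℚ (suc D)
  D′≡d*D = ℕ→ℚ-homo-* (ℚ.↧ₙ (q zero)) (suc D)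
  Dq′-int : ∀ i → IsInt (ℕ→ℚ (ℚ.↧ₙ (q zero) ℕ.* suc D) ℚ.* q i)
  Dq′-int zero = subst IsInt
    (trans (swap d (ℕ→ℚ (suc D)) (q zero)) (cong (ℚ._* q zero) (sym D′≡d*D)))
    (IsInt-* (+ suc D , refl) (ℚ.↥ (q zero) , ↧*≡↥ (q zero)))
    where
    swap : ∀ x y z → y ℚ.* (x ℚ.* z) ≡ x ℚ.* y ℚ.* z
    swap = solve 3 (λ x y z → y :* (x :* z) := x :* y :* z) refl
  Dq′-int (suc i) = subst IsInt
    (trans (sym (ℚP.*-assoc d (ℕ→ℚ (suc D)) (q (suc i)))) (cong (ℚ._* q (suc i)) (sym D′≡d*D)))
    (IsInt-* (+ ℚ.↧ₙ (q zero) , refl) (Dq-int i))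

-- Lattice bases and basic simplices

ℤ-independent⇒ℚ-independent :
  ∀ {k m} (b : Fin k → Point m) →
  ((c : Fin k → ℤ) → (∀ j → sumℤ (λ i → c i ℤ.* b i j) ≡ + 0) → ∀ i → c i ≡ + 0) →
  (q : Fin k → ℚ) → (∀ j → sumℚ (λ i → q i ℚ.* ℤ→ℚ (b i j)) ≡ 0ℚ) → ∀ i → q i ≡ 0ℚ
ℤ-independent⇒ℚ-independent b b-indep q qb≡0 i =
  *-cancelˡ-≡-pos D {{ℕ→ℚ-positive D-1}}
    (trans (Dq≡a i) (trans (cong ℤ→ℚ (b-indep a ab≡0 i)) (sym (ℚP.*-zeroʳ D))))
  where
  D-1 = proj₁ (commonDenominator q)
  D = ℕ→ℚ (suc D-1)
  a : Fin _ → ℤ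
  a i = proj₁ (proj₂ (commonDenominator q) i)
  Dq≡a : ∀ i → D ℚ.* q i ≡ ℤ→ℚ (a i)
  Dq≡a i = proj₂ (proj₂ (commonDenominator q) i)
  ab≡0 : ∀ j → sumℤ (λ i → a i ℤ.* b i j) ≡ + 0
  ab≡0 j = ℤ→ℚ-injective (begin
    ℤ→ℚ (sumℤ (λ i → a i ℤ.* b i j))           ≡⟨ ℤ→ℚ-sumℤ (λ i → a i ℤ.* b i j) ⟩
    sumℚ (λ i → ℤ→ℚ (a i ℤ.* b i j))           ≡⟨ sumℚ-cong (λ i → ℤ→ℚ-homo-* (a i) (b i j)) ⟩
    sumℚ (λ i → ℤ→ℚ (a i) ℚ.* ℤ→ℚ (b i j))     ≡⟨ sumℚ-cong (λ i → cong (ℚ._* ℤ→ℚ (b i j)) (sym (Dq≡a i))) ⟩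
    sumℚ (λ i → D ℚ.* q i ℚ.* ℤ→ℚ (b i j))     ≡⟨ sumℚ-cong (λ i → ℚP.*-assoc D (q i) (ℤ→ℚ (b i j))) ⟩
    sumℚ (λ i → D ℚ.* (q i ℚ.* ℤ→ℚ (b i j)))   ≡⟨ *-distribˡ-sumℚ D (λ i → q i ℚ.* ℤ→ℚ (b i j)) ⟨
    D ℚ.* sumℚ (λ i → q i ℚ.* ℤ→ℚ (b i j))     ≡⟨ cong (D ℚ.*_) (qb≡0 j) ⟩
    D ℚ.* 0ℚ                                    ≡⟨ ℚP.*-zeroʳ D ⟩
    0ℚ                                          ∎)
    where open ≡-Reasoning

IsLatticeBasis⇒integral-coordinates :
  ∀ {m} {b : Fin m → Point m} → IsLatticeBasis m b →
  (q : Fin m → ℚ) → (∀ j → IsInt (sumℚ (λ k → q k ℚ.* ℤ→ℚ (b k j)))) → ∀ k → IsInt (q k)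
IsLatticeBasis⇒integral-coordinates {b = b} (b-span , b-indep) q qb-int k =
  c k , x∙y⁻¹≈ε⇒x≈y (q k) (ℤ→ℚ (c k))
          (ℤ-independent⇒ℚ-independent b b-indep (λ k → q k ℚ.- ℤ→ℚ (c k)) q-c-relation k)
  where
  y : Point _
  y j = proj₁ (qb-int j)
  c = proj₁ (b-span y)
  y≡cb : ∀ j → y j ≡ sumℤ (λ k → c k ℤ.* b k j)
  y≡cb = proj₂ (b-span y)
  q-c-relation : ∀ j → sumℚ (λ k → (q k ℚ.- ℤ→ℚ (c k)) ℚ.* ℤ→ℚ (b k j)) ≡ 0ℚ
  q-c-relation j = begin
    sumℚ (λ k → (q k ℚ.- ℤ→ℚ (c k)) ℚ.* ℤ→ℚ (b k j))
      ≡⟨ sumℚ-cong (λ k → *-distribʳ-- (q k) (ℤ→ℚ (c k)) (ℤ→ℚ (b k j))) ⟩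
    sumℚ (λ k → q k ℚ.* ℤ→ℚ (b k j) ℚ.- ℤ→ℚ (c k) ℚ.* ℤ→ℚ (b k j))
      ≡⟨ sumℚ-distrib-- (λ k → q k ℚ.* ℤ→ℚ (b k j)) (λ k → ℤ→ℚ (c k) ℚ.* ℤ→ℚ (b k j)) ⟩
    sumℚ (λ k → q k ℚ.* ℤ→ℚ (b k j)) ℚ.- sumℚ (λ k → ℤ→ℚ (c k) ℚ.* ℤ→ℚ (b k j))
      ≡⟨ cong₂ ℚ._-_ (proj₂ (qb-int j)) cb≡y ⟩
    ℤ→ℚ (y j) ℚ.- ℤ→ℚ (y j)
      ≡⟨ ℚP.+-inverseʳ (ℤ→ℚ (y j)) ⟩
    0ℚ ∎
    where
    open ≡-Reasoning
    *-distribʳ-- : ∀ x y z → (x ℚ.- y) ℚ.* z ≡ x ℚ.* z ℚ.- y ℚ.* z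
    *-distribʳ-- = solve 3 (λ x y z → (x :- y) :* z := x :* z :- y :* z) refl
    cb≡y : sumℚ (λ k → ℤ→ℚ (c k) ℚ.* ℤ→ℚ (b k j)) ≡ ℤ→ℚ (y j)
    cb≡y = begin
      sumℚ (λ k → ℤ→ℚ (c k) ℚ.* ℤ→ℚ (b k j)) ≡⟨ sumℚ-cong (λ k → ℤ→ℚ-homo-* (c k) (b k j)) ⟨
      sumℚ (λ k → ℤ→ℚ (c k ℤ.* b k j))       ≡⟨ ℤ→ℚ-sumℤ (λ k → c k ℤ.* b k j) ⟨
      ℤ→ℚ (sumℤ (λ k → c k ℤ.* b k j))       ≡⟨ cong ℤ→ℚ (y≡cb j) ⟨
      ℤ→ℚ (y j)                              ∎

PartOfLatticeBasis⇒integral-coordinates :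
  ∀ {k m} {u : Fin k → Point m} → PartOfLatticeBasis k m u →
  (r : Fin k → ℚ) → (∀ j → IsInt (sumℚ (λ i → r i ℚ.* ℤ→ℚ (u i j)))) → ∀ i → IsInt (r i)
PartOfLatticeBasis⇒integral-coordinates {u = u} (b , b-basis , ι , ι-inj , bι≡u) r ru-int i =
  subst IsInt (pushforward-injective ι-inj r i)
    (IsLatticeBasis⇒integral-coordinates b-basis (pushforward ι r) Rb-int (ι i))
  where
  Rb-int : ∀ j → IsInt (sumℚ (λ k → pushforward ι r k ℚ.* ℤ→ℚ (b k j)))
  Rb-int j = subst IsInt
    (sym (trans (sumℚ-pushforward ι r (λ k → ℤ→ℚ (b k j)))
                (sumℚ-cong (λ i → cong (λ t → r i ℚ.* ℤ→ℚ t) (bι≡u i j)))))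
    (ru-int j)

IsBasicSimplex⇒integral-barycentric :
  ∀ {k m} {w : Fin (suc k) → Point m} → IsBasicSimplex k m w →
  (μ : Fin (suc k) → ℚ) → IsInt (sumℚ μ) → (∀ j → IsInt (sumℚ (λ i → μ i ℚ.* ℤ→ℚ (w i j)))) →
  ∀ i → IsInt (μ i)
IsBasicSimplex⇒integral-barycentric {k} {w = w} w-basic μ Σμ-int μw-int = μ-int
  where
  r : Fin k → ℚ
  r = μ ∘ inject₁
  L : Fin _ → ℚ
  L j = ℤ→ℚ (w (fromℕ k) j)
  ru≡ : ∀ j → sumℚ (λ i → r i ℚ.* ℤ→ℚ (w (inject₁ i) j ℤ.- w (fromℕ k) j))
            ≡ sumℚ (λ i → μ i ℚ.* ℤ→ℚ (w i j)) ℚ.- sumℚ μ ℚ.* L j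
  ru≡ j = begin
    sumℚ (λ i → r i ℚ.* ℤ→ℚ (w (inject₁ i) j ℤ.- w (fromℕ k) j))
      ≡⟨ sumℚ-cong (λ i → trans (cong (r i ℚ.*_) (ℤ→ℚ-homo-- (w (inject₁ i) j) (w (fromℕ k) j)))
                                (*-distribˡ-- (r i) (ℤ→ℚ (w (inject₁ i) j)) (L j))) ⟩
    sumℚ (λ i → r i ℚ.* ℤ→ℚ (w (inject₁ i) j) ℚ.- r i ℚ.* L j)
      ≡⟨ sumℚ-distrib-- (λ i → r i ℚ.* ℤ→ℚ (w (inject₁ i) j)) (λ i → r i ℚ.* L j) ⟩
    P ℚ.- sumℚ (λ i → r i ℚ.* L j)
      ≡⟨ cong (λ t → P ℚ.- t) (*-distribʳ-sumℚ (L j) r) ⟨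
    P ℚ.- sumℚ r ℚ.* L j
      ≡⟨ move-last P (sumℚ r) (μ (fromℕ k)) (L j) ⟩
    (P ℚ.+ μ (fromℕ k) ℚ.* L j) ℚ.- (sumℚ r ℚ.+ μ (fromℕ k)) ℚ.* L j
      ≡⟨ cong₂ (λ s t → s ℚ.- t ℚ.* L j) (sumℚ-init-last (λ i → μ i ℚ.* ℤ→ℚ (w i j))) (sumℚ-init-last μ) ⟨
    sumℚ (λ i → μ i ℚ.* ℤ→ℚ (w i j)) ℚ.- sumℚ μ ℚ.* L j ∎
    where
    open ≡-Reasoning
    P = sumℚ (λ i → r i ℚ.* ℤ→ℚ (w (inject₁ i) j))
    *-distribˡ-- : ∀ x y z → x ℚ.* (y ℚ.- z) ≡ x ℚ.* y ℚ.- x ℚ.* z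
    *-distribˡ-- = solve 3 (λ x y z → x :* (y :- z) := x :* y :- x :* z) refl
    move-last : ∀ p s x l → p ℚ.- s ℚ.* l ≡ (p ℚ.+ x ℚ.* l) ℚ.- (s ℚ.+ x) ℚ.* l
    move-last = solve 4 (λ p s x l → p :- s :* l := (p :+ x :* l) :- (s :+ x) :* l) refl
  r-int : ∀ i → IsInt (r i)
  r-int = PartOfLatticeBasis⇒integral-coordinates w-basic r
    (λ j → subst IsInt (sym (ru≡ j)) (IsInt-- (μw-int j) (IsInt-* Σμ-int (w (fromℕ k) j , refl))))
  last-int : IsInt (μ (fromℕ k))
  last-int = subst IsInt (trans (cong (ℚ._- sumℚ r) (sumℚ-init-last μ)) (cancel (sumℚ r) _))
    (IsInt-- Σμ-int (IsInt-sumℚ r-int))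
    where
    cancel : ∀ s x → s ℚ.+ x ℚ.- s ≡ x
    cancel = solve 2 (λ s x → s :+ x :- s := x) refl
  μ-int : ∀ i → IsInt (μ i)
  μ-int i with k ℕ.≟ Fin.toℕ i
  ... | no  k≢i = subst (IsInt ∘ μ) (FinP.inject₁-lower₁ i k≢i) (r-int (lower₁ i k≢i))
  ... | yes k≡i = subst (IsInt ∘ μ) (FinP.toℕ-injective (trans (FinP.toℕ-fromℕ k) k≡i)) last-int

fractional-on-basic-facet⇒0 :
  ∀ {k m} (v : Fin (suc (suc k)) → Point m) (j : Fin (suc (suc k))) →
  IsBasicSimplex k m (v ∘ punchIn j) →
  (λ' : Fin (suc (suc k)) → ℚ) → (∀ i → IsFractional (λ' i)) →
  IsInt (sumℚ λ') → (∀ l → IsInt (sumℚ (λ i → λ' i ℚ.* ℤ→ℚ (v i l)))) →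
  λ' j ≡ 0ℚ → ∀ i → λ' i ≡ 0ℚ
fractional-on-basic-facet⇒0 v j facet-basic λ' λ'-frac Σλ'-int λ'v-int λ'j≡0 i with j FinP.≟ i
... | yes refl = λ'j≡0
... | no  j≢i  = subst (λ t → λ' t ≡ 0ℚ) (FinP.punchIn-punchOut j≢i)
    (IsInt∧IsFractional⇒≡0 (μ-int (punchOut j≢i)) (λ'-frac _))
  where
  μ-int : ∀ i → IsInt (λ' (punchIn j i))
  μ-int = IsBasicSimplex⇒integral-barycentric {w = v ∘ punchIn j} facet-basic (λ' ∘ punchIn j)
    (subst IsInt (sumℚ-remove-zero j λ' λ'j≡0) Σλ'-int)
    (λ l → subst IsInt (sumℚ-remove-zero j (λ i → λ' i ℚ.* ℤ→ℚ (v i l))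
                          (trans (cong (ℚ._* ℤ→ℚ (v j l)) λ'j≡0) (ℚP.*-zeroˡ (ℤ→ℚ (v j l)))))
                 (λ'v-int l))

-- Interior lattice points

weight-of-positive-integral-combination :
  ∀ {m} (v : Fin (suc m) → Point m) e →
  (∀ k → 1 ≤ k → k ≤ e → ¬ HasInteriorLatticePoint m v k) →
  (μ : Fin (suc m) → ℚ) → (∀ i → 0ℚ ℚ.< μ i) →
  IsInt (sumℚ μ) → (∀ j → IsInt (sumℚ (λ i → μ i ℚ.* ℤ→ℚ (v i j)))) →
  ∃ λ k → sumℚ μ ≡ ℕ→ℚ k × e ℕ.< k
weight-of-positive-integral-combination v e no-interior μ μ>0 Σμ-int μv-int
  with IsInt∧pos⇒ℕ Σμ-int (sumℚ-pos μ μ>0)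
... | k , Σμ≡k with suc k ℕP.≤? e
...   | yes k<e = ⊥-elim (no-interior (suc k) (ℕ.s≤s ℕ.z≤n) k<e
                    ((λ j → proj₁ (μv-int j)) , μ , μ>0 , Σμ≡k , (λ j → proj₂ (μv-int j))))
...   | no  k≮e = suc k , Σμ≡k , ℕP.≰⇒> k≮e

complement-integral :
  ∀ {n m} (v : Fin n → Point m) (λ' : Fin n → ℚ) →
  (∀ j → IsInt (sumℚ (λ i → λ' i ℚ.* ℤ→ℚ (v i j)))) →
  ∀ j → IsInt (sumℚ (λ i → (1ℚ ℚ.- λ' i) ℚ.* ℤ→ℚ (v i j)))
complement-integral v λ' λ'v-int j =
  subst IsInt (sym (trans (sumℚ-cong (λ i → *-distribʳ-1- (λ' i) (ℤ→ℚ (v i j))))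
                          (sumℚ-distrib-- (λ i → ℤ→ℚ (v i j)) (λ i → λ' i ℚ.* ℤ→ℚ (v i j)))))
    (IsInt-- (IsInt-sumℚ (λ i → v i j , refl)) (λ'v-int j))
  where
  *-distribʳ-1- : ∀ x y → (1ℚ ℚ.- x) ℚ.* y ≡ y ℚ.- x ℚ.* y
  *-distribʳ-1- = solve 2 (λ x y → (con 1ℚ :- x) :* y := y :- x :* y) refl

m+n≡2d⇒m≡d : ∀ {d m n} → m ℕ.+ n ≡ 2 * d → d ≤ m → d ≤ n → m ≡ d
m+n≡2d⇒m≡d {d} {m} m+n≡2d d≤m d≤n = ℕP.≤-antisym m≤d d≤m
  where
  m≤d : m ≤ d
  m≤d = ℕP.+-cancelʳ-≤ d m d (subst (m ℕ.+ d ≤_) (trans m+n≡2d (cong (d ℕ.+_) (ℕP.+-identityʳ d)))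
                                    (ℕP.+-monoʳ-≤ m d≤n))

positive-fractional⇒weight≡d :
  ∀ e (v : Fin (suc (suc (2 * e))) → Point (suc (2 * e))) →
  (∀ k → 1 ≤ k → k ≤ e → ¬ HasInteriorLatticePoint (suc (2 * e)) v k) →
  (λ' : Fin (suc (suc (2 * e))) → ℚ) → (∀ i → 0ℚ ℚ.< λ' i) → (∀ i → λ' i ℚ.< 1ℚ) →
  IsInt (sumℚ λ') → (∀ j → IsInt (sumℚ (λ i → λ' i ℚ.* ℤ→ℚ (v i j)))) →
  sumℚ λ' ≡ ℕ→ℚ (suc e)
positive-fractional⇒weight≡d e v no-interior λ' λ'>0 λ'<1 Σλ'-int λ'v-int =
  let k  , Σλ'≡k , e<k  = weight-of-positive-integral-combination v e no-interior λ' λ'>0 Σλ'-int λ'v-int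
      k′ , Σμ≡k′ , e<k′ = weight-of-positive-integral-combination v e no-interior μ μ>0 Σμ-int
                            (complement-integral v λ' λ'v-int)
      k+k′≡2d = trans (ℕ→ℚ-injective {k ℕ.+ k′} {N} (trans (ℕ→ℚ-homo-+ k k′)
                        (trans (cong₂ ℚ._+_ (sym Σλ'≡k) (sym Σμ≡k′)) Σλ'+Σμ≡N)))
                      (sym (ℕP.*-suc 2 e))
  in trans Σλ'≡k (cong ℕ→ℚ (m+n≡2d⇒m≡d k+k′≡2d e<k e<k′))
  where
  N = suc (suc (2 * e))
  μ : Fin N → ℚ
  μ i = 1ℚ ℚ.- λ' i
  μ>0 : ∀ i → 0ℚ ℚ.< μ i
  μ>0 i = subst (ℚ._< μ i) (ℚP.+-inverseʳ (λ' i)) (ℚP.+-monoˡ-< (ℚ.- λ' i) (λ'<1 i))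
  Σμ≡ : sumℚ μ ≡ ℕ→ℚ N ℚ.- sumℚ λ'
  Σμ≡ = trans (sumℚ-distrib-- (λ _ → 1ℚ) λ') (cong (ℚ._- sumℚ λ') (sumℚ-ones N))
  Σμ-int : IsInt (sumℚ μ)
  Σμ-int = subst IsInt (sym Σμ≡) (IsInt-- (+ N , refl) Σλ'-int)
  Σλ'+Σμ≡N : sumℚ λ' ℚ.+ sumℚ μ ≡ ℕ→ℚ N
  Σλ'+Σμ≡N = trans (cong (sumℚ λ' ℚ.+_) Σμ≡) (cancel (sumℚ λ') (ℕ→ℚ N))
    where
    cancel : ∀ s n → s ℚ.+ (n ℚ.- s) ≡ n
    cancel = solve 2 (λ s n → s :+ (n :- s) := n) refl

proposition4p1 : (e : ℕ) → (v : Fin (suc (suc (2 * e))) → Point (suc (2 * e))) →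
    AffinelyIndependent (suc (2 * e)) v →
    (∀ (j : Fin (suc (suc (2 * e)))) → IsBasicSimplex (2 * e) (suc (2 * e)) (λ i → v (punchIn j i))) →
    (∀ (k : ℕ) → 1 ≤ k → k ≤ e → ¬ HasInteriorLatticePoint (suc (2 * e)) v k) →
    (λ' : Fin (suc (suc (2 * e))) → ℚ) →
    (∀ i → 0ℚ ℚ.≤ λ' i × λ' i ℚ.< 1ℚ) →
    (∀ j → IsInt (sumℚ (λ i → λ' i ℚ.* ℤ→ℚ (v i j)))) →
    IsInt (sumℚ λ') →
    (sumℚ λ' ≡ 0ℚ ⊎ sumℚ λ' ≡ ℕ→ℚ (suc e)) ×
    (sumℚ λ' ≡ ℕ→ℚ (suc e) → ∀ i → ¬ λ' i ≡ 0ℚ)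
proposition4p1 e v _ facets-basic no-interior λ' λ'-frac λ'v-int Σλ'-int = Σλ'≡0∨d , Σλ'≡d⇒λ'≢0
  where
  λ'≡0⇒Σλ'≡0 : ∀ j → λ' j ≡ 0ℚ → sumℚ λ' ≡ 0ℚ
  λ'≡0⇒Σλ'≡0 j λ'j≡0 = sumℚ-zeros
    (fractional-on-basic-facet⇒0 v j (facets-basic j) λ' λ'-frac Σλ'-int λ'v-int λ'j≡0)
  Σλ'≡d⇒λ'≢0 : sumℚ λ' ≡ ℕ→ℚ (suc e) → ∀ i → ¬ λ' i ≡ 0ℚ
  Σλ'≡d⇒λ'≢0 Σλ'≡d i λ'i≡0 =
    ℕP.0≢1+n (ℕ→ℚ-injective {0} {suc e} (trans (sym (λ'≡0⇒Σλ'≡0 i λ'i≡0)) Σλ'≡d))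
  Σλ'≡0∨d : sumℚ λ' ≡ 0ℚ ⊎ sumℚ λ' ≡ ℕ→ℚ (suc e)
  Σλ'≡0∨d with FinP.any? (λ j → λ' j ℚP.≟ 0ℚ)
  ... | yes (j , λ'j≡0) = inj₁ (λ'≡0⇒Σλ'≡0 j λ'j≡0)
  ... | no  no-zero     = inj₂ (positive-fractional⇒weight≡d e v no-interior λ'
          (λ i → 0≤∧≢0⇒0< (proj₁ (λ'-frac i)) (λ λ'i≡0 → no-zero (i , λ'i≡0)))
          (proj₂ ∘ λ'-frac) Σλ'-int λ'v-int)
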